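{- Let $p$ be a prime, $q=p^m$ with $m\ge1$, and $q-1=3s$ with $s$ a positive integer. Let $\gamma$ be a primitive element of $\mathbb{F}_q$, $\xi=\gamma^s$ (so $\xi^3=1$, $\xi$ a primitive cube root of unity), $r$ a positive integer, and $f\in\mathbb{F}_q[x]$ with $f(x)\equiv ax^2+bx+c \pmod{x^3-1}$ for some $a,b,c\in\mathbb{F}_q$ satisfying $a^2+b^2+c^2-ab-bc-ca=1$. Put $A_i=f(\xi^i)$ for $i=0,1,2$. Then $P(x)=x^rf(x^s)$ is a permutation polynomial of $\mathbb{F}_q$ if and only if $\gcd(r,s)=1$, $A_i\neq0$ for $i=0,1,2$, $A_0^s=1$, $3\mid \mathrm{Ind}_\gamma(A_0)$, and $3\nmid r+\mathrm{Ind}_\gamma(A_2^2)$.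
   Context: For $a\in\mathbb{F}_q^\ast$, $\mathrm{Ind}_\gamma(a)$ is the residue class $b\bmod(q-1)$ with $a=\gamma^b$; divisibility by $3$ is well defined since $3\mid q-1$. -}

module Defs where

open import Level using (Level; _⊔_)
open import Data.Nat as ℕ using (ℕ; zero; suc)
open import Data.Nat.Divisibility using (_∣_)
open import Data.Fin using (Fin)
open import Data.List using (List; []; _∷_)
open import Data.Product using (Σ; ∃; _×_; _,_)
open import Relation.Nullary using (¬_)
open import Algebra.Bundles using (CommutativeRing)

record IsField {c ℓ} (R : CommutativeRing c ℓ) : Set (c ⊔ ℓ) where
  open CommutativeRing R
  field
    0≉1     : ¬ (0# ≈ 1#)
    inverse : ∀ x → ¬ (x ≈ 0#) → ∃ λ y → x * y ≈ 1#

module _ {c ℓ} (R : CommutativeRing c ℓ) where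
  open CommutativeRing R

  HasCardinality : ℕ → Set (c ⊔ ℓ)
  HasCardinality q = Σ (Fin q → Carrier) λ e →
    (∀ i j → e i ≈ e j → i ≡ j) × (∀ x → ∃ λ i → e i ≈ x)
    where open import Relation.Binary.PropositionalEquality using (_≡_)

  pow : Carrier → ℕ → Carrier
  pow x zero    = 1#
  pow x (suc n) = x * pow x n

  IsPrimitive : Carrier → Set (c ⊔ ℓ)
  IsPrimitive γ = ¬ (γ ≈ 0#) × (∀ a → ¬ (a ≈ 0#) → ∃ λ k → pow γ k ≈ a)

  -- Polynomials in R[x] as coefficient lists (constant term first).
  Poly : Set c
  Poly = List Carrier

  coeff : Poly → ℕ → Carrier
  coeff []       _       = 0#
  coeff (a ∷ _)  zero    = a
  coeff (_ ∷ as) (suc i) = coeff as i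

  eval : Poly → Carrier → Carrier
  eval []       x = 0#
  eval (a ∷ as) x = a + x * eval as x

  _+ₚ_ : Poly → Poly → Poly
  []       +ₚ q        = q
  (a ∷ as) +ₚ []       = a ∷ as
  (a ∷ as) +ₚ (b ∷ bs) = (a + b) ∷ (as +ₚ bs)

  scale : Carrier → Poly → Poly
  scale a []       = []
  scale a (b ∷ bs) = (a * b) ∷ scale a bs

  _*ₚ_ : Poly → Poly → Poly
  []       *ₚ q = []
  (a ∷ as) *ₚ q = scale a q +ₚ (0# ∷ (as *ₚ q))

  _≈ₚ_ : Poly → Poly → Set ℓ
  f ≈ₚ g = ∀ i → coeff f i ≈ coeff g i

  _≡_[modₚ_] : Poly → Poly → Poly → Set (c ⊔ ℓ)
  f ≡ g [modₚ h ] = ∃ λ k → f ≈ₚ ((h *ₚ k) +ₚ g)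

  x³-1 : Poly
  x³-1 = (- 1#) ∷ 0# ∷ 0# ∷ 1# ∷ []

  quadratic : Carrier → Carrier → Carrier → Poly
  quadratic a b c = c ∷ b ∷ a ∷ []

  evalP : ℕ → Poly → ℕ → Carrier → Carrier
  evalP r f s x = pow x r * eval f (pow x s)

  IsPermutation : (Carrier → Carrier) → Set (c ⊔ ℓ)
  IsPermutation F =
    (∀ x y → F x ≈ F y → x ≈ y) × (∀ y → ∃ λ x → F x ≈ y)

  -- "3 ∣ t + Ind_γ(a)": some (equivalently every, since 3 ∣ q-1 and γ has
  -- order q-1) exponent k with γ^k = a satisfies 3 ∣ t + k.
  3∣_+Ind[_]_ : ℕ → Carrier → Carrier → Set ℓ
  3∣ t +Ind[ γ ] a = ∃ λ k → pow γ k ≈ a × 3 ∣ t ℕ.+ k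

module Submission where

-- A nonzero x lies in the coset x^s = ξ^i (i = 0, 1, 2); there
-- P(x) = x^r A_i and P(x)^s = B_i := ξ^(ir) A_i^s. So P(x)^s tells which coset x came from, and
-- within a coset x^r and x^s determine x when gcd(r, s) = 1 (Bézout). Hence P permutes F_q iff
-- gcd(r, s) = 1, no A_i vanishes and B_0, B_1, B_2 are the three cube roots of unity. The norm
-- condition on (a, b, c) says A_1 A_2 = 1, so B_1 B_2 = 1, and the B_i exhaust the cube roots of
-- unity exactly when B_0 = A_0^s = 1 and B_2^2 = ξ^(r + Ind(A_2^2)) ≠ 1.

open import Defs
open import Level using (Level; _⊔_)
open import Data.Nat using (ℕ; _≥_; _^_) renaming (_+_ to _+ℕ_; _*_ to _*ℕ_)
open import Data.Nat.GCD using (gcd)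
open import Data.Nat.Primality using (Prime)
open import Data.Product using (_×_)
open import Relation.Nullary using (¬_)
open import Relation.Binary.PropositionalEquality using (_≡_)
open import Function.Bundles using (_⇔_)
open import Algebra.Bundles using (CommutativeRing)

open import Data.Nat as ℕ using (zero; suc; NonZero; _≤_; _<_)
import Data.Nat.Properties as ℕP
open import Data.Nat.Divisibility using (_∣_; divides; ∣-refl; ∣-antisym; n∣m*n; *-monoʳ-∣; *-cancelˡ-∣; *-cancelʳ-∣; ∣⇒≤; m%n≡0⇒n∣m)
open import Data.Nat.DivMod using (_%_; _/_; m≡m%n+[m/n]*n; m%n<n)
open import Data.Nat.GCD using (gcd[m,n]∣m; gcd[m,n]∣n; module Bézout)
open import Data.Nat.Coprimality using (gcd≡1⇒coprime; coprime-Bézout)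
open import Data.Fin as Fin using (Fin; toℕ; fromℕ<; punchOut)
import Data.Fin.Properties as FinP
open import Data.Product using (∃; _,_; proj₁; proj₂)
open import Data.List using ([]; _∷_)
open import Data.Empty using (⊥; ⊥-elim)
open import Relation.Nullary using (yes; no)
open import Relation.Binary.PropositionalEquality as ≡ using (_≢_; cong; subst)
open import Function.Bundles using (mk⇔)
open import Function.Base using (_∘_)

module PowerLaws {c ℓ} (R : CommutativeRing c ℓ) where
  open CommutativeRing R
  open import Algebra.Properties.CommutativeSemiring.Exp commutativeSemiring
    using (^-congˡ; ^-homo-*; ^-assocʳ; ^-distrib-*) renaming (_^_ to _^ᴿ_)
  open import Relation.Binary.Reasoning.Setoid setoid

  pow≡^ : ∀ x n → pow R x n ≡ x ^ᴿ n
  pow≡^ x zero    = ≡.refl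
  pow≡^ x (suc n) = cong (x *_) (pow≡^ x n)

  pow-congˡ : ∀ {x y} n → x ≈ y → pow R x n ≈ pow R y n
  pow-congˡ {x} {y} n x≈y rewrite pow≡^ x n | pow≡^ y n = ^-congˡ n x≈y

  pow-homo-* : ∀ x m n → pow R x (m +ℕ n) ≈ pow R x m * pow R x n
  pow-homo-* x m n rewrite pow≡^ x (m +ℕ n) | pow≡^ x m | pow≡^ x n = ^-homo-* x m n

  pow-assocʳ : ∀ x m n → pow R (pow R x m) n ≈ pow R x (m *ℕ n)
  pow-assocʳ x m n rewrite pow≡^ x m | pow≡^ (x ^ᴿ m) n | pow≡^ x (m *ℕ n) = ^-assocʳ x m n

  pow-distrib-* : ∀ x y n → pow R (x * y) n ≈ pow R x n * pow R y n
  pow-distrib-* x y n rewrite pow≡^ (x * y) n | pow≡^ x n | pow≡^ y n = ^-distrib-* x y n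

  pow-1# : ∀ n → pow R 1# n ≈ 1#
  pow-1# zero    = refl
  pow-1# (suc n) = trans (*-identityˡ _) (pow-1# n)

  pow-0# : ∀ n .{{_ : NonZero n}} → pow R 0# n ≈ 0#
  pow-0# (suc n) = zeroˡ _

  pow-swap : ∀ x m n → pow R (pow R x m) n ≈ pow R (pow R x n) m
  pow-swap x m n = begin
    pow R (pow R x m) n ≈⟨ pow-assocʳ x m n ⟩
    pow R x (m *ℕ n)    ≡⟨ cong (pow R x) (ℕP.*-comm m n) ⟩
    pow R x (n *ℕ m)    ≈⟨ pow-assocʳ x n m ⟨
    pow R (pow R x n) m ∎

  pow-of-unity : ∀ {x d k} → pow R x d ≈ 1# → d ∣ k → pow R x k ≈ 1#
  pow-of-unity {x} {d} (xᵈ≈1) (divides t ≡.refl) = begin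
    pow R x (t *ℕ d)    ≡⟨ cong (pow R x) (ℕP.*-comm t d) ⟩
    pow R x (d *ℕ t)    ≈⟨ pow-assocʳ x d t ⟨
    pow R (pow R x d) t ≈⟨ pow-congˡ t xᵈ≈1 ⟩
    pow R 1# t          ≈⟨ pow-1# t ⟩
    1#                  ∎

  pow-mod : ∀ {x} d .{{_ : NonZero d}} k → pow R x d ≈ 1# → pow R x k ≈ pow R x (k % d)
  pow-mod {x} d k xᵈ≈1 = begin
    pow R x k                                ≡⟨ cong (pow R x) (m≡m%n+[m/n]*n k d) ⟩
    pow R x (k % d +ℕ (k / d) *ℕ d)          ≈⟨ pow-homo-* x (k % d) _ ⟩
    pow R x (k % d) * pow R x ((k / d) *ℕ d) ≈⟨ *-congˡ (pow-of-unity xᵈ≈1 (n∣m*n (k / d))) ⟩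
    pow R x (k % d) * 1#                     ≈⟨ *-identityʳ _ ⟩
    pow R x (k % d)                          ∎

module Evaluation {c ℓ} (R : CommutativeRing c ℓ) where
  open CommutativeRing R
  open import Relation.Binary.Reasoning.Setoid setoid
  open import Algebra.Solver.Ring.NaturalCoefficients.Default commutativeSemiring
    using (solve; _:=_; _:+_; _:*_; con)

  eval-cong : ∀ g {x y} → x ≈ y → eval R g x ≈ eval R g y
  eval-cong []      x≈y = refl
  eval-cong (a ∷ g) x≈y = +-congˡ (*-cong x≈y (eval-cong g x≈y))

  eval-+ₚ : ∀ g h x → eval R (_+ₚ_ R g h) x ≈ eval R g x + eval R h x
  eval-+ₚ []      h       x = sym (+-identityˡ _)
  eval-+ₚ (a ∷ g) []      x = sym (+-identityʳ _)
  eval-+ₚ (a ∷ g) (b ∷ h) x = begin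
    (a + b) + x * eval R (_+ₚ_ R g h) x     ≈⟨ +-congˡ (*-congˡ (eval-+ₚ g h x)) ⟩
    (a + b) + x * (eval R g x + eval R h x) ≈⟨ solve 5 (λ a b x u v →
                                                 a :+ b :+ x :* (u :+ v) := a :+ x :* u :+ (b :+ x :* v))
                                                 refl a b x (eval R g x) (eval R h x) ⟩
    (a + x * eval R g x) + (b + x * eval R h x) ∎

  eval-scale : ∀ a g x → eval R (scale R a g) x ≈ a * eval R g x
  eval-scale a []      x = sym (zeroʳ a)
  eval-scale a (b ∷ g) x = begin
    a * b + x * eval R (scale R a g) x ≈⟨ +-congˡ (*-congˡ (eval-scale a g x)) ⟩
    a * b + x * (a * eval R g x)       ≈⟨ solve 4 (λ a b x u → a :* b :+ x :* (a :* u) := a :* (b :+ x :* u))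
                                            refl a b x (eval R g x) ⟩
    a * (b + x * eval R g x)           ∎

  eval-*ₚ : ∀ g h x → eval R (_*ₚ_ R g h) x ≈ eval R g x * eval R h x
  eval-*ₚ []      h x = sym (zeroˡ _)
  eval-*ₚ (a ∷ g) h x = begin
    eval R (_+ₚ_ R (scale R a h) (0# ∷ _*ₚ_ R g h)) x          ≈⟨ eval-+ₚ (scale R a h) _ x ⟩
    eval R (scale R a h) x + (0# + x * eval R (_*ₚ_ R g h) x) ≈⟨ +-cong (eval-scale a h x)
                                                                    (+-congˡ (*-congˡ (eval-*ₚ g h x))) ⟩
    a * eval R h x + (0# + x * (eval R g x * eval R h x))     ≈⟨ solve 4 (λ a x u v →
                                                                    a :* v :+ (con 0 :+ x :* (u :* v)) := (a :+ x :* u) :* v)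
                                                                    refl a x (eval R g x) (eval R h x) ⟩
    (a + x * eval R g x) * eval R h x                         ∎

  eval-zero : ∀ g x → (∀ i → coeff R g i ≈ 0#) → eval R g x ≈ 0#
  eval-zero []      x g≈0 = refl
  eval-zero (a ∷ g) x g≈0 = begin
    a + x * eval R g x ≈⟨ +-cong (g≈0 0) (*-congˡ (eval-zero g x (λ i → g≈0 (suc i)))) ⟩
    0# + x * 0#        ≈⟨ +-identityˡ _ ⟩
    x * 0#             ≈⟨ zeroʳ x ⟩
    0#                 ∎

  eval-≈ₚ : ∀ g h x → _≈ₚ_ R g h → eval R g x ≈ eval R h x
  eval-≈ₚ []      h       x g≈h = sym (eval-zero h x (λ i → sym (g≈h i)))
  eval-≈ₚ (a ∷ g) []      x g≈h = eval-zero (a ∷ g) x g≈h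
  eval-≈ₚ (a ∷ g) (b ∷ h) x g≈h = +-cong (g≈h 0) (*-congˡ (eval-≈ₚ g h x (λ i → g≈h (suc i))))

  eval-mod : ∀ {g h m} x → _≡_[modₚ_] R g h m → eval R m x ≈ 0# → eval R g x ≈ eval R h x
  eval-mod {g} {h} {m} x (k , g≈mk+h) m[x]≈0 = begin
    eval R g x                           ≈⟨ eval-≈ₚ g (_+ₚ_ R (_*ₚ_ R m k) h) x g≈mk+h ⟩
    eval R (_+ₚ_ R (_*ₚ_ R m k) h) x     ≈⟨ eval-+ₚ (_*ₚ_ R m k) h x ⟩
    eval R (_*ₚ_ R m k) x + eval R h x   ≈⟨ +-congʳ (eval-*ₚ m k x) ⟩
    eval R m x * eval R k x + eval R h x ≈⟨ +-congʳ (*-congʳ m[x]≈0) ⟩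
    0# * eval R k x + eval R h x         ≈⟨ +-congʳ (zeroˡ _) ⟩
    0# + eval R h x                      ≈⟨ +-identityˡ _ ⟩
    eval R h x                           ∎

  eval-x³-1 : ∀ {y} → pow R y 3 ≈ 1# → eval R (x³-1 R) y ≈ 0#
  eval-x³-1 {y} y³≈1 = begin
    - 1# + y * (0# + y * (0# + y * (1# + y * 0#))) ≈⟨ +-congˡ (solve 1 (λ y →
                                                         y :* (con 0 :+ y :* (con 0 :+ y :* (con 1 :+ y :* con 0)))
                                                         := y :* (y :* (y :* con 1))) refl y) ⟩
    - 1# + pow R y 3                               ≈⟨ +-congˡ y³≈1 ⟩
    - 1# + 1#                                      ≈⟨ -‿inverseˡ 1# ⟩
    0#                                             ∎

module QuadraticNorm {c ℓ} (R : CommutativeRing c ℓ) where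
  open CommutativeRing R
  open import Relation.Binary.Reasoning.Setoid setoid
  open import Algebra.Properties.Group +-group using (∙-cancelʳ)
  open import Algebra.Solver.Ring.NaturalCoefficients.Default commutativeSemiring
    using (solve; _:=_; _:+_; _:*_; con)

  norm+cross≈squares : ∀ a b c →
    (a * a + b * b + c * c - a * b - b * c - c * a) + (a * b + b * c + c * a) ≈ a * a + b * b + c * c
  norm+cross≈squares a b c = begin
    (N₀ - a * b - b * c - c * a) + (a * b + b * c + c * a)
      ≈⟨ solve 7 (λ a b c N₀ x y z →
           N₀ :+ x :+ y :+ z :+ (a :* b :+ b :* c :+ c :* a)
           := N₀ :+ (x :+ a :* b) :+ (y :+ b :* c) :+ (z :+ c :* a))
           refl a b c N₀ (- (a * b)) (- (b * c)) (- (c * a)) ⟩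
    N₀ + (- (a * b) + a * b) + (- (b * c) + b * c) + (- (c * a) + c * a)
      ≈⟨ +-cong (+-cong (+-congˡ (-‿inverseˡ _)) (-‿inverseˡ _)) (-‿inverseˡ _) ⟩
    N₀ + 0# + 0# + 0#
      ≈⟨ trans (+-identityʳ _) (trans (+-identityʳ _) (+-identityʳ _)) ⟩
    N₀ ∎
    where N₀ = a * a + b * b + c * c

  quadratic-norm : ∀ a b c ω → pow R ω 3 ≈ 1# → 1# + ω + ω * ω ≈ 0# →
    eval R (quadratic R a b c) (pow R ω 1) * eval R (quadratic R a b c) (pow R ω 2)
      ≈ a * a + b * b + c * c - a * b - b * c - c * a
  -- Q(ω) Q(ω²) = N + S (1 + ω + ω²) + (ω³ - 1) Rem, with both sides moved so that no
  -- subtraction occurs (it is then a semiring identity).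
  quadratic-norm a b c ω ω³≈1 T≈0 = ∙-cancelʳ (Rem + S) _ _ (begin
    eval R (quadratic R a b c) (pow R ω 1) * eval R (quadratic R a b c) (pow R ω 2) + (Rem + S)
      ≈⟨ solve 4 (λ a b c ω →
           (c :+ (ω :* con 1) :* (b :+ (ω :* con 1) :* (a :+ (ω :* con 1) :* con 0)))
           :* (c :+ (ω :* (ω :* con 1)) :* (b :+ (ω :* (ω :* con 1)) :* (a :+ (ω :* (ω :* con 1)) :* con 0)))
           :+ ((a :* c :* ω :+ b :* b :+ a :* b :* ω :* ω :+ a :* b :* ω
                :+ a :* a :* (ω :* (ω :* (ω :* con 1)) :+ con 1))
               :+ (a :* b :+ b :* c :+ c :* a))
           := (a :* a :+ b :* b :+ c :* c) :+ (a :* b :+ b :* c :+ c :* a) :* (con 1 :+ ω :+ ω :* ω)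
              :+ ω :* (ω :* (ω :* con 1))
                 :* (a :* c :* ω :+ b :* b :+ a :* b :* ω :* ω :+ a :* b :* ω
                     :+ a :* a :* (ω :* (ω :* (ω :* con 1)) :+ con 1)))
           refl a b c ω ⟩
    N₀ + S * (1# + ω + ω * ω) + pow R ω 3 * Rem
      ≈⟨ +-cong (+-congˡ (trans (*-congˡ T≈0) (zeroʳ S))) (trans (*-congʳ ω³≈1) (*-identityˡ Rem)) ⟩
    N₀ + 0# + Rem               ≈⟨ +-congʳ (+-identityʳ N₀) ⟩
    N₀ + Rem                    ≈⟨ +-congʳ (norm+cross≈squares a b c) ⟨
    (N + S) + Rem               ≈⟨ +-assoc N S Rem ⟩
    N + (S + Rem)               ≈⟨ +-congˡ (+-comm S Rem) ⟩
    N + (Rem + S)               ∎)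
    where
    N₀ S N Rem : Carrier
    N₀  = a * a + b * b + c * c
    S   = a * b + b * c + c * a
    N   = a * a + b * b + c * c - a * b - b * c - c * a
    Rem = a * c * ω + b * b + a * b * ω * ω + a * b * ω + a * a * (pow R ω 3 + 1#)

module FieldLemmas {c ℓ} (F : CommutativeRing c ℓ) (isF : IsField F) where
  open CommutativeRing F
  open IsField isF
  open PowerLaws F
  open import Relation.Binary.Reasoning.Setoid setoid
  open import Algebra.Definitions _≈_ using (AlmostLeftCancellative; AlmostRightCancellative)
  open import Algebra.Consequences.Setoid setoid using (comm∧almostCancelˡ⇒almostCancelʳ)
  open import Algebra.Properties.CommutativeSemigroup *-commutativeSemigroup using (xy∙z≈y∙xz)
  open import Algebra.Properties.Group +-group using (x∙y⁻¹≈ε⇒x≈y)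
  open import Algebra.Properties.Ring ring using ([y-z]x≈yx-zx)
  open import Algebra.Solver.Ring.NaturalCoefficients.Default commutativeSemiring
    using (solve; _:=_; _:+_; _:*_; con)

  *-cancelˡ-nonZero : AlmostLeftCancellative 0# _*_
  *-cancelˡ-nonZero x y z x≉0 xy≈xz with x⁻¹ , xx⁻¹≈1 ← inverse x x≉0 = begin
    y              ≈⟨ *-identityˡ y ⟨
    1# * y         ≈⟨ *-congʳ xx⁻¹≈1 ⟨
    x * x⁻¹ * y    ≈⟨ xy∙z≈y∙xz x x⁻¹ y ⟩
    x⁻¹ * (x * y)  ≈⟨ *-congˡ xy≈xz ⟩
    x⁻¹ * (x * z)  ≈⟨ xy∙z≈y∙xz x x⁻¹ z ⟨
    x * x⁻¹ * z    ≈⟨ *-congʳ xx⁻¹≈1 ⟩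
    1# * z         ≈⟨ *-identityˡ z ⟩
    z              ∎

  *-cancelʳ-nonZero : AlmostRightCancellative 0# _*_
  *-cancelʳ-nonZero = comm∧almostCancelˡ⇒almostCancelʳ *-comm *-cancelˡ-nonZero

  *-nonZero : ∀ {x y} → ¬ x ≈ 0# → ¬ y ≈ 0# → ¬ x * y ≈ 0#
  *-nonZero {x} {y} x≉0 y≉0 xy≈0 = y≉0 (*-cancelˡ-nonZero x y 0# x≉0 (trans xy≈0 (sym (zeroʳ x))))

  pow-nonZero : ∀ {x} n → ¬ x ≈ 0# → ¬ pow F x n ≈ 0#
  pow-nonZero zero    x≉0 1≈0 = 0≉1 (sym 1≈0)
  pow-nonZero (suc n) x≉0     = *-nonZero x≉0 (pow-nonZero n x≉0)

  pow-suc-injective : ∀ {x y} k → ¬ x ≈ 0# →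
    pow F x k ≈ pow F y k → pow F x (suc k) ≈ pow F y (suc k) → x ≈ y
  pow-suc-injective {x} {y} k x≉0 xᵏ≈yᵏ xᵏ⁺¹≈yᵏ⁺¹ =
    *-cancelʳ-nonZero (pow F x k) x y (pow-nonZero k x≉0) (trans xᵏ⁺¹≈yᵏ⁺¹ (*-congˡ (sym xᵏ≈yᵏ)))

  pow-gap≈1 : ∀ {x m k} → ¬ x ≈ 0# → m ≤ k → pow F x m ≈ pow F x k → pow F x (k ℕ.∸ m) ≈ 1#
  pow-gap≈1 {x} {m} {k} x≉0 m≤k xᵐ≈xᵏ = sym (*-cancelˡ-nonZero (pow F x m) 1# _ (pow-nonZero m x≉0) (begin
    pow F x m * 1#                ≈⟨ *-identityʳ _ ⟩
    pow F x m                     ≈⟨ xᵐ≈xᵏ ⟩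
    pow F x k                     ≡⟨ cong (pow F x) (ℕP.m+[n∸m]≡n m≤k) ⟨
    pow F x (m +ℕ (k ℕ.∸ m))      ≈⟨ pow-homo-* x m _ ⟩
    pow F x m * pow F x (k ℕ.∸ m) ∎))

  pow-cong-multiple : ∀ {x y} m t → pow F x m ≈ pow F y m → pow F x (t *ℕ m) ≈ pow F y (t *ℕ m)
  pow-cong-multiple {x} {y} m t xᵐ≈yᵐ = begin
    pow F x (t *ℕ m)    ≡⟨ cong (pow F x) (ℕP.*-comm t m) ⟩
    pow F x (m *ℕ t)    ≈⟨ pow-assocʳ x m t ⟨
    pow F (pow F x m) t ≈⟨ pow-congˡ t xᵐ≈yᵐ ⟩
    pow F (pow F y m) t ≈⟨ pow-assocʳ y m t ⟩
    pow F y (m *ℕ t)    ≡⟨ cong (pow F y) (ℕP.*-comm m t) ⟩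
    pow F y (t *ℕ m)    ∎

  pow-injective-Bézout : ∀ {x y} a b u v → ¬ x ≈ 0# → 1 +ℕ u *ℕ a ≡ v *ℕ b →
    pow F x a ≈ pow F y a → pow F x b ≈ pow F y b → x ≈ y
  pow-injective-Bézout {x} {y} a b u v x≉0 1+ua≡vb xᵃ≈yᵃ xᵇ≈yᵇ =
    pow-suc-injective (u *ℕ a) x≉0 (pow-cong-multiple a u xᵃ≈yᵃ)
      (subst (λ k → pow F x k ≈ pow F y k) (≡.sym 1+ua≡vb) (pow-cong-multiple b v xᵇ≈yᵇ))

  pow-injective-coprime : ∀ {x y} r s → gcd r s ≡ 1 → ¬ x ≈ 0# →
    pow F x r ≈ pow F y r → pow F x s ≈ pow F y s → x ≈ y
  pow-injective-coprime r s gcd≡1 x≉0 xʳ≈yʳ xˢ≈yˢ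
    with coprime-Bézout (gcd≡1⇒coprime gcd≡1)
  ... | Bézout.+- u v 1+vs≡ur = pow-injective-Bézout s r v u x≉0 1+vs≡ur xˢ≈yˢ xʳ≈yʳ
  ... | Bézout.-+ u v 1+ur≡vs = pow-injective-Bézout r s u v x≉0 1+ur≡vs xʳ≈yʳ xˢ≈yˢ

  1+ω+ω²≈0 : ∀ {ω} → ¬ ω ≈ 1# → pow F ω 3 ≈ 1# → 1# + ω + ω * ω ≈ 0#
  1+ω+ω²≈0 {ω} ω≉1 ω³≈1 = *-cancelˡ-nonZero (ω - 1#) T 0# ω-1≉0 (begin
    (ω - 1#) * T     ≈⟨ [y-z]x≈yx-zx T ω 1# ⟩
    ω * T - 1# * T   ≈⟨ +-cong ωT≈T (-‿cong (*-identityˡ T)) ⟩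
    T - T            ≈⟨ -‿inverseʳ T ⟩
    0#               ≈⟨ zeroʳ (ω - 1#) ⟨
    (ω - 1#) * 0#    ∎)
    where
    T = 1# + ω + ω * ω
    ω-1≉0 : ¬ ω - 1# ≈ 0#
    ω-1≉0 ω-1≈0 = ω≉1 (x∙y⁻¹≈ε⇒x≈y ω 1# ω-1≈0)
    ωT≈T : ω * T ≈ T
    ωT≈T = begin
      ω * T                  ≈⟨ solve 1 (λ ω → ω :* (con 1 :+ ω :+ ω :* ω)
                                   := ω :* (ω :* (ω :* con 1)) :+ ω :+ ω :* ω) refl ω ⟩
      pow F ω 3 + ω + ω * ω  ≈⟨ +-congʳ (+-congʳ ω³≈1) ⟩
      T                      ∎

module FiniteRing {c ℓ} (R : CommutativeRing c ℓ) (n : ℕ) (card : HasCardinality R (suc n)) where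
  open CommutativeRing R
  open import Relation.Binary.Definitions using (Decidable)

  private
    e : Fin (suc n) → Carrier
    e = proj₁ card

    e-injective : ∀ i j → e i ≈ e j → i ≡ j
    e-injective = proj₁ (proj₂ card)

    index : Carrier → Fin (suc n)
    index x = proj₁ (proj₂ (proj₂ card) x)

    e∘index : ∀ x → e (index x) ≈ x
    e∘index x = proj₂ (proj₂ (proj₂ card) x)

    index-injective : ∀ {x y} → index x ≡ index y → x ≈ y
    index-injective {x} {y} eq = trans (sym (e∘index x)) (trans (reflexive (cong e eq)) (e∘index y))

    index-cong : ∀ {x y} → x ≈ y → index x ≡ index y
    index-cong {x} {y} x≈y = e-injective _ _ (trans (e∘index x) (trans x≈y (sym (e∘index y))))

  _≟_ : Decidable _≈_
  x ≟ y with index x Fin.≟ index y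
  ... | yes eq = yes (index-injective eq)
  ... | no neq = no (λ x≈y → neq (index-cong x≈y))

  surjective⇒≤ : ∀ {k} (g : Fin k → Carrier) → (∀ x → ∃ λ i → g i ≈ x) → suc n ≤ k
  surjective⇒≤ {k} g g-surjective = FinP.injective⇒≤ section-injective
    where
    section : Fin (suc n) → Fin k
    section j = proj₁ (g-surjective (e j))
    section-injective : ∀ {j j′} → section j ≡ section j′ → j ≡ j′
    section-injective {j} {j′} eq = e-injective j j′ (trans (sym (proj₂ (g-surjective (e j))))
      (trans (reflexive (cong g eq)) (proj₂ (g-surjective (e j′)))))

  private
    index-avoiding : ∀ z x → ¬ x ≈ z → index z ≢ index x
    index-avoiding z x x≉z eq = x≉z (sym (index-injective eq))

  pigeonhole : ∀ z (g : Fin (suc n) → Carrier) → (∀ i → ¬ g i ≈ z) →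
    ∃ λ i → ∃ λ j → i Fin.< j × g i ≈ g j
  pigeonhole z g g≉z
    with FinP.pigeonhole (ℕP.n<1+n n) (λ i → punchOut (index-avoiding z (g i) (g≉z i)))
  ... | i , j , i<j , eq = i , j , i<j , index-injective
    (FinP.punchOut-injective (index-avoiding z (g i) (g≉z i)) (index-avoiding z (g j) (g≉z j)) eq)

  private
    onIndices : (Carrier → Carrier) → Fin (suc n) → Fin (suc n)
    onIndices h i = index (h (e i))

  injective⇒surjective : ∀ h → (∀ x y → h x ≈ h y → x ≈ y) → ∀ y → ∃ λ x → h x ≈ y
  injective⇒surjective h h-injective y with FinP.any? (λ i → onIndices h i Fin.≟ index y)
  ... | yes (i , hᵢ≡y) = e i , trans (sym (e∘index _)) (trans (reflexive (cong e hᵢ≡y)) (e∘index y))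
  ... | no y∉image = ⊥-elim (ℕP.<-irrefl ≡.refl (FinP.injective⇒≤ squeezed-injective))
    where
    y≢ : ∀ i → index y ≢ onIndices h i
    y≢ i eq = y∉image (i , ≡.sym eq)
    squeezed : Fin (suc n) → Fin n
    squeezed i = punchOut (y≢ i)
    squeezed-injective : ∀ {i j} → squeezed i ≡ squeezed j → i ≡ j
    squeezed-injective {i} {j} eq =
      e-injective i j (h-injective _ _ (index-injective (FinP.punchOut-injective (y≢ i) (y≢ j) eq)))

module PrimitiveElement {c ℓ} (F : CommutativeRing c ℓ) (isF : IsField F)
  (n : ℕ) .{{_ : NonZero n}} (card : HasCardinality F (suc n))
  (γ : CommutativeRing.Carrier F) (prim : IsPrimitive F γ) where
  open CommutativeRing F
  open PowerLaws F
  open FieldLemmas F isF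
  open FiniteRing F n card
  open import Relation.Binary.Reasoning.Setoid setoid

  discreteLog : ∀ x → ¬ x ≈ 0# → ∃ λ k → pow F γ k ≈ x
  discreteLog = proj₂ prim

  pow-γ-nonZero : ∀ k → ¬ pow F γ k ≈ 0#
  pow-γ-nonZero k = pow-nonZero k (proj₁ prim)

  -- If γ^d = 1 then 0, γ^0, …, γ^(d-1) already exhaust F.
  period⇒n≤ : ∀ d .{{_ : NonZero d}} → pow F γ d ≈ 1# → n ≤ d
  period⇒n≤ d γᵈ≈1 = ℕP.≤-pred (surjective⇒≤ g g-surjective)
    where
    g : Fin (suc d) → Carrier
    g Fin.zero    = 0#
    g (Fin.suc k) = pow F γ (toℕ k)
    g-surjective : ∀ x → ∃ λ i → g i ≈ x
    g-surjective x with x ≟ 0#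
    ... | yes x≈0 = Fin.zero , sym x≈0
    ... | no x≉0 with k , γᵏ≈x ← discreteLog x x≉0 = Fin.suc (fromℕ< (m%n<n k d)) , (begin
      pow F γ (toℕ (fromℕ< (m%n<n k d))) ≡⟨ cong (pow F γ) (FinP.toℕ-fromℕ< (m%n<n k d)) ⟩
      pow F γ (k % d)                    ≈⟨ pow-mod d k γᵈ≈1 ⟨
      pow F γ k                          ≈⟨ γᵏ≈x ⟩
      x                                  ∎)

  period-≤n : ∃ λ d → 0 < d × d ≤ n × pow F γ d ≈ 1#
  period-≤n with i , j , i<j , γⁱ≈γʲ ← pigeonhole 0# (pow F γ ∘ toℕ) (pow-γ-nonZero ∘ toℕ) =
    toℕ j ℕ.∸ toℕ i , ℕP.m<n⇒0<n∸m i<j ,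
    ℕP.≤-trans (ℕP.m∸n≤m (toℕ j) (toℕ i)) (ℕP.≤-pred (FinP.toℕ<n j)) ,
    pow-gap≈1 (proj₁ prim) (ℕP.<⇒≤ i<j) γⁱ≈γʲ

  pow-γ-n : pow F γ n ≈ 1#
  pow-γ-n with d , 0<d , d≤n , γᵈ≈1 ← period-≤n =
    subst (λ t → pow F γ t ≈ 1#) (ℕP.≤-antisym d≤n (period⇒n≤ d {{ℕ.>-nonZero 0<d}} γᵈ≈1)) γᵈ≈1

  pow-γ≈1⇒∣ : ∀ k → pow F γ k ≈ 1# → n ∣ k
  pow-γ≈1⇒∣ k γᵏ≈1 with k % n ℕ.≟ 0
  ... | yes k%n≡0 = m%n≡0⇒n∣m k n k%n≡0
  ... | no k%n≢0 = ⊥-elim (ℕP.<⇒≱ (m%n<n k n)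
    (period⇒n≤ (k % n) {{ℕ.≢-nonZero k%n≢0}} (trans (sym (pow-mod n k pow-γ-n)) γᵏ≈1)))

  ∣⇒pow-γ≈1 : ∀ k → n ∣ k → pow F γ k ≈ 1#
  ∣⇒pow-γ≈1 k = pow-of-unity pow-γ-n

cofactor≡1 : ∀ {s s′ g} .{{_ : NonZero s}} → s ≡ s′ *ℕ g → s ∣ s′ → g ≡ 1
cofactor≡1 {s} {s′} {g} s≡s′g s∣s′ = ≡.sym (ℕP.*-cancelˡ-≡ 1 g s (begin
  s *ℕ 1   ≡⟨ ℕP.*-identityʳ s ⟩
  s        ≡⟨ s≡s′g ⟩
  s′ *ℕ g  ≡⟨ cong (_*ℕ g) (∣-antisym (divides g (≡.trans s≡s′g (ℕP.*-comm s′ g))) s∣s′) ⟩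
  s *ℕ g   ∎))
  where open ≡.≡-Reasoning

module Cosets {c ℓ} (F : CommutativeRing c ℓ) (isF : IsField F)
  (d s : ℕ) .{{_ : NonZero d}} .{{_ : NonZero s}} (card : HasCardinality F (suc (d *ℕ s)))
  (γ : CommutativeRing.Carrier F) (prim : IsPrimitive F γ) where
  open CommutativeRing F
  open PowerLaws F
  open FieldLemmas F isF using (pow-gap≈1)
  open PrimitiveElement F isF (d *ℕ s) {{ℕP.m*n≢0 d s}} card γ prim public
  open import Relation.Binary.Definitions using (tri<; tri≈; tri>)
  open import Relation.Binary.Reasoning.Setoid setoid

  ξ : Carrier
  ξ = pow F γ s

  pow-ξ≈1⇒∣ : ∀ m → pow F ξ m ≈ 1# → d ∣ m
  pow-ξ≈1⇒∣ m ξᵐ≈1 = *-cancelʳ-∣ s (subst (d *ℕ s ∣_) (ℕP.*-comm s m)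
    (pow-γ≈1⇒∣ (s *ℕ m) (trans (sym (pow-assocʳ γ s m)) ξᵐ≈1)))

  ∣⇒pow-ξ≈1 : ∀ m → d ∣ m → pow F ξ m ≈ 1#
  ∣⇒pow-ξ≈1 m d∣m = trans (pow-assocʳ γ s m)
    (∣⇒pow-γ≈1 (s *ℕ m) (subst (_∣ s *ℕ m) (ℕP.*-comm s d) (*-monoʳ-∣ s d∣m)))

  pow-γ-s : ∀ k → pow F (pow F γ k) s ≈ pow F ξ k
  pow-γ-s k = pow-swap γ k s

  pow-s≈1⇒∣ : ∀ k → pow F (pow F γ k) s ≈ 1# → d ∣ k
  pow-s≈1⇒∣ k γᵏˢ≈1 = pow-ξ≈1⇒∣ k (trans (sym (pow-γ-s k)) γᵏˢ≈1)

  coset : ∀ x → ¬ x ≈ 0# → ∃ λ (i : Fin d) → pow F x s ≈ pow F ξ (toℕ i)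
  coset x x≉0 with k , γᵏ≈x ← discreteLog x x≉0 = fromℕ< (m%n<n k d) , (begin
    pow F x s                          ≈⟨ pow-congˡ s γᵏ≈x ⟨
    pow F (pow F γ k) s                ≈⟨ pow-γ-s k ⟩
    pow F ξ k                          ≈⟨ pow-mod d k (∣⇒pow-ξ≈1 d ∣-refl) ⟩
    pow F ξ (k % d)                    ≡⟨ cong (pow F ξ) (FinP.toℕ-fromℕ< (m%n<n k d)) ⟨
    pow F ξ (toℕ (fromℕ< (m%n<n k d))) ∎)

  private
    no-shorter-period : ∀ {m k} → m < k → k < d → ¬ pow F ξ m ≈ pow F ξ k
    no-shorter-period {m} {k} m<k k<d ξᵐ≈ξᵏ = ℕP.<⇒≱ (ℕP.≤-<-trans (ℕP.m∸n≤m k m) k<d)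
      (∣⇒≤ {{ℕ.>-nonZero (ℕP.m<n⇒0<n∸m m<k)}}
        (pow-ξ≈1⇒∣ (k ℕ.∸ m) (pow-gap≈1 (pow-γ-nonZero s) (ℕP.<⇒≤ m<k) ξᵐ≈ξᵏ)))

  pow-ξ-injective : ∀ (i j : Fin d) → pow F ξ (toℕ i) ≈ pow F ξ (toℕ j) → i ≡ j
  pow-ξ-injective i j ξⁱ≈ξʲ with ℕP.<-cmp (toℕ i) (toℕ j)
  ... | tri≈ _ i≡j _ = FinP.toℕ-injective i≡j
  ... | tri< i<j _ _ = ⊥-elim (no-shorter-period i<j (FinP.toℕ<n j) ξⁱ≈ξʲ)
  ... | tri> _ _ j<i = ⊥-elim (no-shorter-period j<i (FinP.toℕ<n i) (sym ξⁱ≈ξʲ))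

module Criterion {c ℓ} (F : CommutativeRing c ℓ) (isF : IsField F)
  (d s : ℕ) .{{_ : NonZero d}} .{{_ : NonZero s}} (card : HasCardinality F (suc (d *ℕ s)))
  (γ : CommutativeRing.Carrier F) (prim : IsPrimitive F γ)
  (r : ℕ) .{{_ : NonZero r}} (f : Poly F) where
  open CommutativeRing F
  open PowerLaws F
  open Evaluation F using (eval-cong)
  open FieldLemmas F isF
  open FiniteRing F (d *ℕ s) card
  open Cosets F isF d s card γ prim public
  open import Relation.Binary.Reasoning.Setoid setoid

  A : ℕ → Carrier
  A i = eval F f (pow F ξ i)

  B : ℕ → Carrier
  B i = pow F (pow F ξ i) r * pow F (A i) s

  P : Carrier → Carrier
  P = evalP F r f s

  P-on-coset : ∀ x i → pow F x s ≈ pow F ξ i → P x ≈ pow F x r * A i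
  P-on-coset x i xˢ≈ξⁱ = *-congˡ (eval-cong f xˢ≈ξⁱ)

  P-zero : ∀ {x} → x ≈ 0# → P x ≈ 0#
  P-zero {x} x≈0 = begin
    pow F x r * eval F f (pow F x s)  ≈⟨ *-congʳ (pow-congˡ r x≈0) ⟩
    pow F 0# r * eval F f (pow F x s) ≈⟨ *-congʳ (pow-0# r) ⟩
    0# * eval F f (pow F x s)         ≈⟨ zeroˡ _ ⟩
    0#                                ∎

  P-nonZero : ∀ {x} i → pow F x s ≈ pow F ξ i → ¬ x ≈ 0# → ¬ A i ≈ 0# → ¬ P x ≈ 0#
  P-nonZero {x} i xˢ≈ξⁱ x≉0 Aᵢ≉0 Px≈0 =
    *-nonZero (pow-nonZero r x≉0) Aᵢ≉0 (trans (sym (P-on-coset x i xˢ≈ξⁱ)) Px≈0)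

  P-pow-on-coset : ∀ x i → pow F x s ≈ pow F ξ i → pow F (P x) s ≈ B i
  P-pow-on-coset x i xˢ≈ξⁱ = begin
    pow F (P x) s                         ≈⟨ pow-congˡ s (P-on-coset x i xˢ≈ξⁱ) ⟩
    pow F (pow F x r * A i) s             ≈⟨ pow-distrib-* _ _ s ⟩
    pow F (pow F x r) s * pow F (A i) s   ≈⟨ *-congʳ (pow-swap x r s) ⟩
    pow F (pow F x s) r * pow F (A i) s   ≈⟨ *-congʳ (pow-congˡ r xˢ≈ξⁱ) ⟩
    B i                                   ∎

  Injective : Set (c ⊔ ℓ)
  Injective = ∀ x y → P x ≈ P y → x ≈ y

  injective⇒A≉0 : Injective → ∀ i → ¬ A i ≈ 0#
  injective⇒A≉0 P-injective i Aᵢ≈0 = pow-γ-nonZero i (P-injective (pow F γ i) 0# (begin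
    P (pow F γ i)                ≈⟨ P-on-coset (pow F γ i) i (pow-γ-s i) ⟩
    pow F (pow F γ i) r * A i    ≈⟨ *-congˡ Aᵢ≈0 ⟩
    pow F (pow F γ i) r * 0#     ≈⟨ zeroʳ _ ⟩
    0#                           ≈⟨ P-zero refl ⟨
    P 0#                         ∎))

  -- With g = gcd r s and s = s′ g, the element γ^(d s′) is fixed by x ↦ x^r and x ↦ x^s,
  -- so P cannot separate it from 1.
  injective⇒coprime : Injective → gcd r s ≡ 1
  injective⇒coprime P-injective
    with divides s′ s≡s′g ← gcd[m,n]∣n r s | divides r′ r≡r′g ← gcd[m,n]∣m r s =
    cofactor≡1 s≡s′g (*-cancelˡ-∣ d (pow-γ≈1⇒∣ (d *ℕ s′) x≈1))
    where
    g : ℕ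
    g = gcd r s
    x : Carrier
    x = pow F γ (d *ℕ s′)
    fixed : ∀ t t′ → t ≡ t′ *ℕ g → pow F x t ≈ 1#
    fixed t t′ t≡t′g = trans (pow-assocʳ γ (d *ℕ s′) t) (∣⇒pow-γ≈1 _ (subst (_∣ d *ℕ s′ *ℕ t)
      (≡.trans (ℕP.*-assoc d s′ g) (cong (d *ℕ_) (≡.sym s≡s′g)))
      (*-monoʳ-∣ (d *ℕ s′) (divides t′ t≡t′g))))
    x≈1 : x ≈ 1#
    x≈1 = P-injective x 1# (*-cong (trans (fixed r r′ r≡r′g) (sym (pow-1# r)))
                                   (eval-cong f (trans (fixed s s′ s≡s′g) (sym (pow-1# s)))))

  Surjective : Set (c ⊔ ℓ)
  Surjective = ∀ y → ∃ λ x → P x ≈ y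

  preimage-nonZero : ∀ x k → P x ≈ pow F γ k → ¬ x ≈ 0#
  preimage-nonZero x k Px≈γᵏ x≈0 = pow-γ-nonZero k (trans (sym Px≈γᵏ) (P-zero x≈0))

  B-on-preimage : ∀ x k (i : Fin d) → P x ≈ pow F γ k → pow F x s ≈ pow F ξ (toℕ i) →
    B (toℕ i) ≈ pow F ξ k
  B-on-preimage x k i Px≈γᵏ xˢ≈ξⁱ = begin
    B (toℕ i)               ≈⟨ P-pow-on-coset x (toℕ i) xˢ≈ξⁱ ⟨
    pow F (P x) s           ≈⟨ pow-congˡ s Px≈γᵏ ⟩
    pow F (pow F γ k) s     ≈⟨ pow-γ-s k ⟩
    pow F ξ k               ∎

  surjective⇒B-covers : Surjective → ∀ k → ∃ λ (i : Fin d) → B (toℕ i) ≈ pow F ξ k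
  surjective⇒B-covers P-surjective k = i , B-on-preimage x k i Px≈γᵏ xˢ≈ξⁱ
    where
    preimage : ∃ λ x → P x ≈ pow F γ k
    preimage = P-surjective (pow F γ k)
    x : Carrier
    x = proj₁ preimage
    Px≈γᵏ : P x ≈ pow F γ k
    Px≈γᵏ = proj₂ preimage
    x-coset : ∃ λ (i : Fin d) → pow F x s ≈ pow F ξ (toℕ i)
    x-coset = coset x (preimage-nonZero x k Px≈γᵏ)
    i : Fin d
    i = proj₁ x-coset
    xˢ≈ξⁱ : pow F x s ≈ pow F ξ (toℕ i)
    xˢ≈ξⁱ = proj₂ x-coset

  module _ (gcd≡1 : gcd r s ≡ 1) (A≉0 : ∀ (i : Fin d) → ¬ A (toℕ i) ≈ 0#)
           (B-injective : ∀ (i j : Fin d) → B (toℕ i) ≈ B (toℕ j) → i ≡ j) where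

    P-injective-on-coset : ∀ {x y} (i : Fin d) → ¬ x ≈ 0# →
      pow F x s ≈ pow F ξ (toℕ i) → pow F y s ≈ pow F ξ (toℕ i) → P x ≈ P y → x ≈ y
    P-injective-on-coset {x} {y} i x≉0 xˢ≈ξⁱ yˢ≈ξⁱ Px≈Py = pow-injective-coprime r s gcd≡1 x≉0
      (*-cancelʳ-nonZero (A (toℕ i)) (pow F x r) (pow F y r) (A≉0 i)
        (trans (sym (P-on-coset x (toℕ i) xˢ≈ξⁱ)) (trans Px≈Py (P-on-coset y (toℕ i) yˢ≈ξⁱ))))
      (trans xˢ≈ξⁱ (sym yˢ≈ξⁱ))

    -- P(x)^s = B_i determines the coset of x.
    P-injective-on-units : ∀ {x y} → ¬ x ≈ 0# → ¬ y ≈ 0# → P x ≈ P y → x ≈ y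
    P-injective-on-units {x} {y} x≉0 y≉0 Px≈Py = on-cosets (coset x x≉0) (coset y y≉0)
      where
      on-cosets : (∃ λ (i : Fin d) → pow F x s ≈ pow F ξ (toℕ i)) →
                  (∃ λ (j : Fin d) → pow F y s ≈ pow F ξ (toℕ j)) → x ≈ y
      on-cosets (i , xˢ≈ξⁱ) (j , yˢ≈ξʲ) = P-injective-on-coset i x≉0 xˢ≈ξⁱ
        (subst (λ t → pow F y s ≈ pow F ξ (toℕ t)) (≡.sym i≡j) yˢ≈ξʲ) Px≈Py
        where
        i≡j : i ≡ j
        i≡j = B-injective i j (trans (sym (P-pow-on-coset x (toℕ i) xˢ≈ξⁱ))
                (trans (pow-congˡ s Px≈Py) (P-pow-on-coset y (toℕ j) yˢ≈ξʲ)))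

    P-units-nonZero : ∀ {x} → ¬ x ≈ 0# → ¬ P x ≈ 0#
    P-units-nonZero {x} x≉0 = P-nonZero (toℕ (proj₁ x-coset)) (proj₂ x-coset) x≉0 (A≉0 (proj₁ x-coset))
      where
      x-coset : ∃ λ (i : Fin d) → pow F x s ≈ pow F ξ (toℕ i)
      x-coset = coset x x≉0

    P-injective : Injective
    P-injective x y Px≈Py with x ≟ 0# | y ≟ 0#
    ... | yes x≈0 | yes y≈0 = trans x≈0 (sym y≈0)
    ... | yes x≈0 | no y≉0  = ⊥-elim (P-units-nonZero y≉0 (trans (sym Px≈Py) (P-zero x≈0)))
    ... | no x≉0  | yes y≈0 = ⊥-elim (P-units-nonZero x≉0 (trans Px≈Py (P-zero y≈0)))
    ... | no x≉0  | no y≉0  = P-injective-on-units x≉0 y≉0 Px≈Py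

    criterion : IsPermutation F P
    criterion = P-injective , injective⇒surjective P P-injective

module CubicCase {c ℓ} (F : CommutativeRing c ℓ) (isF : IsField F)
  (s : ℕ) .{{_ : NonZero s}} (card : HasCardinality F (suc (3 *ℕ s)))
  (γ : CommutativeRing.Carrier F) (prim : IsPrimitive F γ)
  (r : ℕ) .{{_ : NonZero r}} (f : Poly F) (a b c : CommutativeRing.Carrier F)
  (f≡quadratic : _≡_[modₚ_] F f (quadratic F a b c) (x³-1 F)) where
  open CommutativeRing F
  open PowerLaws F
  open Evaluation F using (eval-mod; eval-x³-1)
  open QuadraticNorm F using (quadratic-norm)
  open FieldLemmas F isF
  open Criterion F isF 3 s card γ prim r f
  open IsField isF using (0≉1)
  open import Relation.Binary.Reasoning.Setoid setoid
  open import Algebra.Properties.CommutativeSemigroup *-commutativeSemigroup using (interchange)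

  pattern 0F = Fin.zero
  pattern 1F = Fin.suc Fin.zero
  pattern 2F = Fin.suc (Fin.suc Fin.zero)

  ξ-distinct : ∀ {i j : Fin 3} → i ≢ j → ¬ pow F ξ (toℕ i) ≈ pow F ξ (toℕ j)
  ξ-distinct i≢j ξⁱ≈ξʲ = i≢j (pow-ξ-injective _ _ ξⁱ≈ξʲ)

  ξ³≈1 : pow F ξ 3 ≈ 1#
  ξ³≈1 = ∣⇒pow-ξ≈1 3 ∣-refl

  ξⁱ-cube-root : ∀ i → pow F (pow F ξ i) 3 ≈ 1#
  ξⁱ-cube-root i = trans (pow-assocʳ ξ i 3) (∣⇒pow-ξ≈1 (i *ℕ 3) (n∣m*n i))

  A≈quadratic : ∀ i → A i ≈ eval F (quadratic F a b c) (pow F ξ i)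
  A≈quadratic i =
    eval-mod {f} {quadratic F a b c} {x³-1 F} (pow F ξ i) f≡quadratic (eval-x³-1 (ξⁱ-cube-root i))

  B-product : ∀ i j → B i * B j ≈ pow F (pow F ξ i * pow F ξ j) r * pow F (A i * A j) s
  B-product i j = begin
    B i * B j
      ≈⟨ interchange _ _ _ _ ⟩
    (pow F (pow F ξ i) r * pow F (pow F ξ j) r) * (pow F (A i) s * pow F (A j) s)
      ≈⟨ *-cong (pow-distrib-* _ _ r) (pow-distrib-* _ _ s) ⟨
    pow F (pow F ξ i * pow F ξ j) r * pow F (A i * A j) s ∎

  B₀≈A₀ˢ : B 0 ≈ pow F (A 0) s
  B₀≈A₀ˢ = trans (*-congʳ (pow-1# r)) (*-identityˡ _)

  B₂²≈ξʳ⁺ᵏ : ∀ k → pow F γ k ≈ A 2 * A 2 → B 2 * B 2 ≈ pow F ξ (r +ℕ k)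
  B₂²≈ξʳ⁺ᵏ k γᵏ≈A₂² = begin
    B 2 * B 2                                             ≈⟨ B-product 2 2 ⟩
    pow F (pow F ξ 2 * pow F ξ 2) r * pow F (A 2 * A 2) s ≈⟨ *-cong (pow-congˡ r ξ²ξ²≈ξ) (pow-congˡ s (sym γᵏ≈A₂²)) ⟩
    pow F (pow F ξ 1) r * pow F (pow F γ k) s             ≈⟨ *-cong (pow-assocʳ ξ 1 r) (pow-γ-s k) ⟩
    pow F ξ (1 *ℕ r) * pow F ξ k                          ≡⟨ cong (λ t → pow F ξ t * pow F ξ k) (ℕP.*-identityˡ r) ⟩
    pow F ξ r * pow F ξ k                                 ≈⟨ pow-homo-* ξ r k ⟨
    pow F ξ (r +ℕ k)                                      ∎
    where
    ξ²ξ²≈ξ : pow F ξ 2 * pow F ξ 2 ≈ pow F ξ 1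
    ξ²ξ²≈ξ = begin
      pow F ξ 2 * pow F ξ 2 ≈⟨ pow-homo-* ξ 2 2 ⟨
      pow F ξ 4             ≈⟨ pow-homo-* ξ 1 3 ⟩
      pow F ξ 1 * pow F ξ 3 ≈⟨ *-congˡ ξ³≈1 ⟩
      pow F ξ 1 * 1#        ≈⟨ *-identityʳ _ ⟩
      pow F ξ 1             ∎

  module _ (norm≈1 : a * a + b * b + c * c - a * b - b * c - c * a ≈ 1#) where

    A₁A₂≈1 : A 1 * A 2 ≈ 1#
    A₁A₂≈1 = trans (*-cong (A≈quadratic 1) (A≈quadratic 2))
      (trans (quadratic-norm a b c ξ ξ³≈1 (1+ω+ω²≈0 ξ≉1 ξ³≈1)) norm≈1)
      where
      ξ≉1 : ¬ ξ ≈ 1#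
      ξ≉1 ξ≈1 = ξ-distinct {1F} {0F} (λ ()) (trans (*-identityʳ ξ) ξ≈1)

    B₁B₂≈1 : B 1 * B 2 ≈ 1#
    B₁B₂≈1 = begin
      B 1 * B 2                                         ≈⟨ B-product 1 2 ⟩
      pow F (pow F ξ 1 * pow F ξ 2) r * pow F (A 1 * A 2) s ≈⟨ *-cong (pow-congˡ r (trans (sym (pow-homo-* ξ 1 2)) ξ³≈1))
                                                                 (pow-congˡ s A₁A₂≈1) ⟩
      pow F 1# r * pow F 1# s                           ≈⟨ *-cong (pow-1# r) (pow-1# s) ⟩
      1# * 1#                                           ≈⟨ *-identityˡ 1# ⟩
      1#                                                ∎

    B₁≈B₂⇒B₂²≈1 : B 1 ≈ B 2 → B 2 * B 2 ≈ 1#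
    B₁≈B₂⇒B₂²≈1 B₁≈B₂ = trans (*-congʳ (sym B₁≈B₂)) B₁B₂≈1

    B₂²≈1⇒B₁≈B₂ : B 2 * B 2 ≈ 1# → B 1 ≈ B 2
    B₂²≈1⇒B₁≈B₂ B₂²≈1 = *-cancelʳ-nonZero (B 2) (B 1) (B 2) B₂≉0 (trans B₁B₂≈1 (sym B₂²≈1))
      where
      B₂≉0 : ¬ B 2 ≈ 0#
      B₂≉0 B₂≈0 = 0≉1 (trans (sym (zeroʳ (B 1))) (trans (*-congˡ (sym B₂≈0)) B₁B₂≈1))

    B₁≈1⇒B₂≈1 : B 1 ≈ 1# → B 2 ≈ 1#
    B₁≈1⇒B₂≈1 B₁≈1 = trans (sym (*-identityˡ (B 2))) (trans (*-congʳ (sym B₁≈1)) B₁B₂≈1)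

    B₂≈1⇒B₁≈1 : B 2 ≈ 1# → B 1 ≈ 1#
    B₂≈1⇒B₁≈1 B₂≈1 = trans (sym (*-identityʳ (B 1))) (trans (*-congˡ (sym B₂≈1)) B₁B₂≈1)

    B-covers⇒B₀≈1 : (∀ k → ∃ λ (i : Fin 3) → B (toℕ i) ≈ pow F ξ k) → B 0 ≈ 1#
    B-covers⇒B₀≈1 covers = from-cover-of-1 (covers 0)
      where
      not-both-1 : B 1 ≈ 1# → B 2 ≈ 1# → (∃ λ (i : Fin 3) → B (toℕ i) ≈ pow F ξ 1) →
                   (∃ λ (i : Fin 3) → B (toℕ i) ≈ pow F ξ 2) → ⊥
      not-both-1 B₁≈1 B₂≈1 (0F , B₀≈ξ) (0F , B₀≈ξ²) = ξ-distinct {1F} {2F} (λ ()) (trans (sym B₀≈ξ) B₀≈ξ²)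
      not-both-1 B₁≈1 B₂≈1 (0F , _)    (1F , B₁≈ξ²) = ξ-distinct {0F} {2F} (λ ()) (trans (sym B₁≈1) B₁≈ξ²)
      not-both-1 B₁≈1 B₂≈1 (0F , _)    (2F , B₂≈ξ²) = ξ-distinct {0F} {2F} (λ ()) (trans (sym B₂≈1) B₂≈ξ²)
      not-both-1 B₁≈1 B₂≈1 (1F , B₁≈ξ) _            = ξ-distinct {0F} {1F} (λ ()) (trans (sym B₁≈1) B₁≈ξ)
      not-both-1 B₁≈1 B₂≈1 (2F , B₂≈ξ) _            = ξ-distinct {0F} {1F} (λ ()) (trans (sym B₂≈1) B₂≈ξ)
      from-cover-of-1 : (∃ λ (i : Fin 3) → B (toℕ i) ≈ 1#) → B 0 ≈ 1#
      from-cover-of-1 (0F , B₀≈1) = B₀≈1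
      from-cover-of-1 (1F , B₁≈1) = ⊥-elim (not-both-1 B₁≈1 (B₁≈1⇒B₂≈1 B₁≈1) (covers 1) (covers 2))
      from-cover-of-1 (2F , B₂≈1) = ⊥-elim (not-both-1 (B₂≈1⇒B₁≈1 B₂≈1) B₂≈1 (covers 1) (covers 2))

    B-covers⇒B₁≉B₂ : (∀ k → ∃ λ (i : Fin 3) → B (toℕ i) ≈ pow F ξ k) → ¬ B 1 ≈ B 2
    B-covers⇒B₁≉B₂ covers B₁≈B₂ = from-cover-of-ξ (covers 1)
      where
      both-ξ : B 1 ≈ pow F ξ 1 → B 2 ≈ pow F ξ 1 → ⊥
      both-ξ B₁≈ξ B₂≈ξ = ξ-distinct {2F} {0F} (λ ())
        (trans (pow-homo-* ξ 1 1) (trans (*-cong (sym B₁≈ξ) (sym B₂≈ξ)) B₁B₂≈1))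
      from-cover-of-ξ : (∃ λ (i : Fin 3) → B (toℕ i) ≈ pow F ξ 1) → ⊥
      from-cover-of-ξ (0F , B₀≈ξ) = ξ-distinct {0F} {1F} (λ ()) (trans (sym (B-covers⇒B₀≈1 covers)) B₀≈ξ)
      from-cover-of-ξ (1F , B₁≈ξ) = both-ξ B₁≈ξ (trans (sym B₁≈B₂) B₁≈ξ)
      from-cover-of-ξ (2F , B₂≈ξ) = both-ξ (trans B₁≈B₂ B₂≈ξ) B₂≈ξ

    B-injective : B 0 ≈ 1# → ¬ B 1 ≈ B 2 → ∀ (i j : Fin 3) → B (toℕ i) ≈ B (toℕ j) → i ≡ j
    B-injective B₀≈1 B₁≉B₂ = injective
      where
      B₁≉1 : ¬ B 1 ≈ 1#
      B₁≉1 B₁≈1 = B₁≉B₂ (trans B₁≈1 (sym (B₁≈1⇒B₂≈1 B₁≈1)))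
      B₂≉1 : ¬ B 2 ≈ 1#
      B₂≉1 B₂≈1 = B₁≉B₂ (trans (B₂≈1⇒B₁≈1 B₂≈1) (sym B₂≈1))
      injective : ∀ (i j : Fin 3) → B (toℕ i) ≈ B (toℕ j) → i ≡ j
      injective 0F 0F _       = ≡.refl
      injective 0F 1F B₀≈B₁   = ⊥-elim (B₁≉1 (trans (sym B₀≈B₁) B₀≈1))
      injective 0F 2F B₀≈B₂   = ⊥-elim (B₂≉1 (trans (sym B₀≈B₂) B₀≈1))
      injective 1F 0F B₁≈B₀   = ⊥-elim (B₁≉1 (trans B₁≈B₀ B₀≈1))
      injective 1F 1F _       = ≡.refl
      injective 1F 2F B₁≈B₂   = ⊥-elim (B₁≉B₂ B₁≈B₂)
      injective 2F 0F B₂≈B₀   = ⊥-elim (B₂≉1 (trans B₂≈B₀ B₀≈1))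
      injective 2F 1F B₂≈B₁   = ⊥-elim (B₁≉B₂ (sym B₂≈B₁))
      injective 2F 2F _       = ≡.refl

    A₀ˢ≈1⇒3∣Ind : ¬ A 0 ≈ 0# → pow F (A 0) s ≈ 1# → 3∣_+Ind[_]_ F 0 γ (A 0)
    A₀ˢ≈1⇒3∣Ind A₀≉0 A₀ˢ≈1 with k , γᵏ≈A₀ ← discreteLog (A 0) A₀≉0 =
      k , γᵏ≈A₀ , pow-s≈1⇒∣ k (trans (pow-congˡ s γᵏ≈A₀) A₀ˢ≈1)

    B₁≉B₂⇒¬3∣Ind : ¬ B 1 ≈ B 2 → ¬ 3∣_+Ind[_]_ F r γ (A 2 * A 2)
    B₁≉B₂⇒¬3∣Ind B₁≉B₂ (k , γᵏ≈A₂² , 3∣r+k) =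
      B₁≉B₂ (B₂²≈1⇒B₁≈B₂ (trans (B₂²≈ξʳ⁺ᵏ k γᵏ≈A₂²) (∣⇒pow-ξ≈1 (r +ℕ k) 3∣r+k)))

    ¬3∣Ind⇒B₁≉B₂ : ¬ A 2 ≈ 0# → ¬ 3∣_+Ind[_]_ F r γ (A 2 * A 2) → ¬ B 1 ≈ B 2
    ¬3∣Ind⇒B₁≉B₂ A₂≉0 ¬3∣Ind B₁≈B₂ with k , γᵏ≈A₂² ← discreteLog (A 2 * A 2) (*-nonZero A₂≉0 A₂≉0) =
      ¬3∣Ind (k , γᵏ≈A₂² , pow-ξ≈1⇒∣ (r +ℕ k) (trans (sym (B₂²≈ξʳ⁺ᵏ k γᵏ≈A₂²)) (B₁≈B₂⇒B₂²≈1 B₁≈B₂)))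

    Conditions : Set ℓ
    Conditions = gcd r s ≡ 1
               × ¬ (A 0 ≈ 0#) × ¬ (A 1 ≈ 0#) × ¬ (A 2 ≈ 0#)
               × pow F (A 0) s ≈ 1#
               × 3∣_+Ind[_]_ F 0 γ (A 0)
               × ¬ 3∣_+Ind[_]_ F r γ (A 2 * A 2)

    permutation⇒conditions : IsPermutation F P → Conditions
    permutation⇒conditions (P-injective , P-surjective) =
      injective⇒coprime P-injective , A≉0 0 , A≉0 1 , A≉0 2 ,
      A₀ˢ≈1 , A₀ˢ≈1⇒3∣Ind (A≉0 0) A₀ˢ≈1 , B₁≉B₂⇒¬3∣Ind (B-covers⇒B₁≉B₂ covers)
      where
      A≉0 : ∀ i → ¬ A i ≈ 0#
      A≉0 = injective⇒A≉0 P-injective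
      covers : ∀ k → ∃ λ (i : Fin 3) → B (toℕ i) ≈ pow F ξ k
      covers = surjective⇒B-covers P-surjective
      A₀ˢ≈1 : pow F (A 0) s ≈ 1#
      A₀ˢ≈1 = trans (sym B₀≈A₀ˢ) (B-covers⇒B₀≈1 covers)

    -- The index condition on A₀ is not needed here: it follows from A₀^s = 1.
    conditions⇒permutation : Conditions → IsPermutation F P
    conditions⇒permutation (gcd≡1 , A₀≉0 , A₁≉0 , A₂≉0 , A₀ˢ≈1 , _ , ¬3∣Ind) =
      criterion gcd≡1 A≉0 (B-injective (trans B₀≈A₀ˢ A₀ˢ≈1) (¬3∣Ind⇒B₁≉B₂ A₂≉0 ¬3∣Ind))
      where
      A≉0 : ∀ (i : Fin 3) → ¬ A (toℕ i) ≈ 0#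
      A≉0 0F = A₀≉0
      A≉0 1F = A₁≉0
      A≉0 2F = A₂≉0

    permutation⇔conditions : IsPermutation F P ⇔ Conditions
    permutation⇔conditions = mk⇔ permutation⇒conditions conditions⇒permutation

theorem3p4 : ∀ {c ℓ} (F : CommutativeRing c ℓ) → IsField F →
    let open CommutativeRing F in
    (p m q s : ℕ) → Prime p → m ≥ 1 → q ≡ p ^ m → HasCardinality F q →
    s ≥ 1 → q ≡ 3 *ℕ s +ℕ 1 →
    (γ : Carrier) → IsPrimitive F γ →
    (r : ℕ) → r ≥ 1 →
    (f : Poly F) (a b c : Carrier) →
    _≡_[modₚ_] F f (quadratic F a b c) (x³-1 F) →
    (a * a + b * b + c * c - a * b - b * c - c * a) ≈ 1# →
    let ξ = pow F γ s
        A : ℕ → Carrier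
        A i = eval F f (pow F ξ i)
    in IsPermutation F (evalP F r f s)
       ⇔ (gcd r s ≡ 1
          × ¬ (A 0 ≈ 0#) × ¬ (A 1 ≈ 0#) × ¬ (A 2 ≈ 0#)
          × pow F (A 0) s ≈ 1#
          × 3∣_+Ind[_]_ F 0 γ (A 0)
          × ¬ 3∣_+Ind[_]_ F r γ (A 2 * A 2))
theorem3p4 F isF p m q s _ _ _ card s≥1 q≡3s+1 γ prim r r≥1 f a b c f≡quadratic norm≈1 =
  CubicCase.permutation⇔conditions F isF s {{ℕ.>-nonZero s≥1}}
    (subst (HasCardinality F) (≡.trans q≡3s+1 (ℕP.+-comm (3 *ℕ s) 1)) card)
    γ prim r {{ℕ.>-nonZero r≥1}} f a b c f≡quadratic norm≈1
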